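{- Let $\Gamma$ be an outer $k$-planar drawing of a graph $G$ with cyclic vertex order $v_1,\dots,v_n$, and let $1\le i<j\le n$. Call $v_1,\dots,v_{i-1},v_{j+1},\dots,v_n$ the left side and $v_{i+1},\dots,v_{j-1}$ the right side of the pair $\{v_i,v_j\}$. Then there exists an outer $k$-planar drawing $\Gamma'$ of $G$ with the same cyclic vertex order as $\Gamma$ such that, whenever two edges of $G$ that both pierce $\{v_i,v_j\}$ cross each other, their crossing point in $\Gamma'$ lies strictly on the side of the straight line through $v_i$ and $v_j$ that contains the left-side vertices.
   Context: A convex drawing of a finite simple graph places the vertices at distinct points of a circle and draws every edge as a straight-line segment; walking counterclockwise along the circle gives the cyclic vertex order. A convex drawing is outer $k$-planar if every edge crosses at most $k$ other edges. Two pairs $\{a,b\}$, $\{c,d\}$ of four distinct vertices are intertwined if their vertices alternate in the cyclic order (i.e. the order is $a,c,b,d$ or $a,d,b,c$ up to rotation); two edges cross iff they are intertwined. A vertex pair is pierced by an edge of $G$ if the pair and the edge are intertwined.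
   Formalization: The given drawing Γ has its vertices at rational points of a circle with rational center and rational squared radius, and the drawing Γ' is taken in the same form. -}

module Defs where

open import Data.Bool using (Bool; true; false; _∧_; _∨_)
open import Data.Nat as ℕ using (ℕ; _<ᵇ_)
open import Data.Fin using (Fin; toℕ)
open import Data.List using (List; concatMap; map; allFin; filterᵇ; length)
open import Data.Product using (_×_; _,_; Σ; ∃)
open import Data.Rational using (ℚ; _+_; _-_; _*_; _<_; _≤_; 0ℚ; 1ℚ)
open import Relation.Binary.PropositionalEquality using (_≡_; _≢_)

-- Combinatorics.  Vertices are Fin n; the cyclic vertex order
-- v₁,…,vₙ is the index order 0,…,n-1 of Fin n.

record Graph (n : ℕ) : Set where
  field
    adj   : Fin n → Fin n → Bool
    sym   : ∀ a b → adj a b ≡ adj b a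
    irref : ∀ a → adj a a ≡ false
open Graph public

ltᵇ : ∀ {n} → Fin n → Fin n → Bool
ltᵇ a b = toℕ a <ᵇ toℕ b

-- pairs {a,b} (a<b) and {c,d} (c<d) alternate in the cyclic order
intertwinedᵇ : ∀ {n} → Fin n → Fin n → Fin n → Fin n → Bool
intertwinedᵇ a b c d =
  (ltᵇ a c ∧ (ltᵇ c b ∧ ltᵇ b d)) ∨ (ltᵇ c a ∧ (ltᵇ a d ∧ ltᵇ d b))

Intertwined : ∀ {n} → Fin n → Fin n → Fin n → Fin n → Set
Intertwined a b c d = intertwinedᵇ a b c d ≡ true

Edge : ∀ {n} → Graph n → Fin n → Fin n → Set
Edge G a b = (toℕ a ℕ.< toℕ b) × (adj G a b ≡ true)

edges : ∀ {n} → Graph n → List (Fin n × Fin n)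
edges {n} G =
  filterᵇ (λ { (a , b) → ltᵇ a b ∧ adj G a b })
          (concatMap (λ a → map (λ b → (a , b)) (allFin n)) (allFin n))

-- number of edges crossing (= intertwined with) the edge {a,b}
crossCount : ∀ {n} → Graph n → Fin n → Fin n → ℕ
crossCount G a b =
  length (filterᵇ (λ { (c , d) → intertwinedᵇ a b c d }) (edges G))

Point : Set
Point = ℚ × ℚ

-- twice the signed area of triangle pqr (> 0 iff p,q,r counterclockwise)
orient : Point → Point → Point → ℚ
orient (px , py) (qx , qy) (rx , ry) =
  ((qx - px) * (ry - py)) - ((qy - py) * (rx - px))

sq : ℚ → ℚ
sq x = x * x

OnSegment : Point → Point → Point → Set
OnSegment x (px , py) (qx , qy) =
  Σ ℚ λ t → (0ℚ ≤ t) × (t ≤ 1ℚ) ×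
            (x ≡ (px + (t * (qx - px)) , py + (t * (qy - py))))

-- A convex drawing with cyclic vertex order v₁,…,vₙ = 0,…,n-1:
-- the vertices are placed at distinct points of a circle (center c,
-- squared radius r² > 0), and walking counterclockwise along the circle
-- meets them in index order (every triple i<j<l is counterclockwise).
-- Edges are the straight segments between their endpoint positions.
record ConvexDrawing (n : ℕ) : Set where
  field
    center   : Point
    radius²  : ℚ
    radius>0 : 0ℚ < radius²
    pos      : Fin n → Point
    onCircle : ∀ v → sq (Data.Product.proj₁ (pos v) - Data.Product.proj₁ center)
                     + sq (Data.Product.proj₂ (pos v) - Data.Product.proj₂ center)
                     ≡ radius²
    distinct : ∀ u v → u ≢ v → pos u ≢ pos v
    ccw      : ∀ u v w → toℕ u ℕ.< toℕ v → toℕ v ℕ.< toℕ w →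
               0ℚ < orient (pos u) (pos v) (pos w)
open ConvexDrawing public

OuterKPlanar : ∀ {n} → ℕ → Graph n → ConvexDrawing n → Set
OuterKPlanar k G Γ = ∀ a b → Edge G a b → crossCount G a b ℕ.≤ k

LeftSide : ∀ {n} → Fin n → Fin n → Fin n → Set
LeftSide i j l = (toℕ l ℕ.< toℕ i) Data.Sum.⊎ (toℕ j ℕ.< toℕ l)
  where import Data.Sum

OnLeftSide : ∀ {n} → ConvexDrawing n → Fin n → Fin n → Point → Set
OnLeftSide Γ i j x = ∀ l → LeftSide i j l →
  0ℚ < (orient (pos Γ i) (pos Γ j) x * orient (pos Γ i) (pos Γ j) (pos Γ l))

CrossingsLeft : ∀ {n} → Graph n → ConvexDrawing n → Fin n → Fin n → Set
CrossingsLeft G Γ i j =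
  ∀ a b c d → Edge G a b → Edge G c d →
  Intertwined a b i j → Intertwined c d i j → Intertwined a b c d →
  ∀ x → OnSegment x (pos Γ a) (pos Γ b) → OnSegment x (pos Γ c) (pos Γ d) →
  OnLeftSide Γ i j x

-- Put the vertices on the unit circle through the rational parametrisation
-- s ↦ ((1 - s²)/(1 + s²), 2s/(1 + s²)), with parameters increasing along the
-- cyclic order, and squeeze the arc vᵢ … vⱼ into a short parameter interval far
-- from all other parameters.  For such points orient(a, b, c) is a positive
-- multiple of (b - a)(c - a)(c - b).  A crossing point x of the edges ab and cd
-- (a, c on the left side, b, d on the right side) divides ab in the ratio
-- |orient(c, d, a)| : |orient(c, d, b)|, the line vᵢvⱼ divides it in the ratio
-- |orient(i, j, a)| : |orient(i, j, b)|, and x is on the left side iff the first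
-- ratio is the smaller one.  After cancelling the weights this is the parameter
-- inequality |a - c||a - d||b - i||b - j| < |a - i||a - j||b - c||b - d|, which
-- holds because the right-hand distances from the cluster are large while the
-- distances within it are small.  Outer k-planarity only depends on the cyclic
-- order, so it carries over to the new drawing.
module Submission where

open import Agda.Builtin.FromNat using (Number; fromNat)
open import Data.Bool using (T; _∧_)
open import Data.Bool.Properties using (T-∧; T-∨; T-≡)
open import Data.Fin using (Fin; toℕ)
open import Data.Fin.Properties using (toℕ<n; toℕ-injective)
open import Data.List using ([]; _∷_)
open import Data.Nat as ℕ using (ℕ; zero; suc; z≤n; s≤s)
import Data.Nat.Properties as ℕₚ
open import Data.Product using (Σ; _×_; _,_; proj₁; proj₂)
open import Data.Rational hiding (pos)
open import Data.Rational.Literals using (number)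
open import Data.Rational.Properties
open import Algebra.Properties.Group +-0-group using (inverseˡ-unique)
open import Data.Unit using (tt)
open import Data.Sum using (_⊎_; inj₁; inj₂) renaming (map to ⊎-map)
open import Function using (_∘_)
open import Function.Bundles using (Equivalence)
open import Level using (0ℓ)
open import Relation.Binary.Definitions using (tri<; tri≈; tri>)
open import Relation.Binary.PropositionalEquality
open import Relation.Nullary using (yes; no; contradiction)
open import Relation.Nullary.Decidable using (dec⇒maybe)
open import Tactic.RingSolver using (solve-∀; solve)
import Tactic.RingSolver.Core.AlmostCommutativeRing as ACR

open import Defs hiding (sym)

instance
  ℚ-number : Number ℚ
  ℚ-number = number

ring : ACR.AlmostCommutativeRing 0ℓ 0ℓ
ring = ACR.fromCommutativeRing +-*-commutativeRing (dec⇒maybe ∘ (0ℚ ≟_))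

open ≤-Reasoning

-- Order and absolute value on ℚ

*-pos : ∀ {p q} → 0ℚ < p → 0ℚ < q → 0ℚ < p * q
*-pos {p} {q} 0<p 0<q =
  positive⁻¹ _ {{pos*pos⇒pos p {{positive 0<p}} q {{positive 0<q}}}}

*-nonNeg : ∀ {p q} → 0ℚ ≤ p → 0ℚ ≤ q → 0ℚ ≤ p * q
*-nonNeg {p} {q} 0≤p 0≤q =
  nonNegative⁻¹ _ {{nonNeg*nonNeg⇒nonNeg p {{nonNegative 0≤p}} q {{nonNegative 0≤q}}}}

+-nonNeg : ∀ {p q} → 0ℚ ≤ p → 0ℚ ≤ q → 0ℚ ≤ p + q
+-nonNeg = +-mono-≤

+-nonNeg-pos : ∀ {p q} → 0ℚ ≤ p → 0ℚ < q → 0ℚ < p + q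
+-nonNeg-pos = +-mono-≤-<

square-nonNeg : ∀ p → 0ℚ ≤ p * p
square-nonNeg p with ≤-total 0ℚ p
... | inj₁ 0≤p = *-nonNeg 0≤p 0≤p
... | inj₂ p≤0 =
  nonNegative⁻¹ _ {{nonPos*nonPos⇒nonPos p {{nonPositive p≤0}} p {{nonPositive p≤0}}}}

*-mono-≤-nonNeg : ∀ {p q r s} → 0ℚ ≤ p → 0ℚ ≤ r → p ≤ q → r ≤ s → p * r ≤ q * s
*-mono-≤-nonNeg {p} {q} {r} {s} 0≤p 0≤r p≤q r≤s = begin
  p * r  ≤⟨ *-monoʳ-≤-nonNeg r {{nonNegative 0≤r}} p≤q ⟩
  q * r  ≤⟨ *-monoˡ-≤-nonNeg q {{nonNegative (≤-trans 0≤p p≤q)}} r≤s ⟩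
  q * s  ∎

p≤p+q : ∀ {p q} → 0ℚ ≤ q → p ≤ p + q
p≤p+q {p} {q} 0≤q = subst (_≤ p + q) (+-identityʳ p) (+-monoʳ-≤ p 0≤q)

p<p+q : ∀ {p q} → 0ℚ < q → p < p + q
p<p+q {p} {q} 0<q = subst (_< p + q) (+-identityʳ p) (+-monoʳ-< p 0<q)

p<q⇒0<q-p : ∀ {p q} → p < q → 0ℚ < q - p
p<q⇒0<q-p {p} {q} p<q = begin-strict
  0ℚ     ≡⟨ sym (+-inverseʳ p) ⟩
  p - p  <⟨ +-monoˡ-< (- p) p<q ⟩
  q - p  ∎

p≤q⇒0≤q-p : ∀ {p q} → p ≤ q → 0ℚ ≤ q - p
p≤q⇒0≤q-p {p} {q} p≤q = begin
  0ℚ     ≡⟨ sym (+-inverseʳ p) ⟩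
  p - p  ≤⟨ +-monoˡ-≤ (- p) p≤q ⟩
  q - p  ∎

p+q≤r⇒q≤r-p : ∀ {p q r} → p + q ≤ r → q ≤ r - p
p+q≤r⇒q≤r-p {p} {q} {r} p+q≤r = begin
  q          ≡⟨ solve (p ∷ q ∷ []) ring ⟩
  p + q - p  ≤⟨ +-monoˡ-≤ (- p) p+q≤r ⟩
  r - p      ∎

p≤∣p∣ : ∀ p → p ≤ ∣ p ∣
p≤∣p∣ p with ≤-total 0ℚ p
... | inj₁ 0≤p = ≤-reflexive (sym (0≤p⇒∣p∣≡p 0≤p))
... | inj₂ p≤0 = ≤-trans p≤0 (0≤∣p∣ p)

p≤0⇒∣p∣≡-p : ∀ {p} → p ≤ 0ℚ → ∣ p ∣ ≡ - p
p≤0⇒∣p∣≡-p {p} p≤0 = trans (sym (∣-p∣≡∣p∣ p)) (0≤p⇒∣p∣≡p (neg-antimono-≤ p≤0))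

-[p-q]≡q-p : ∀ p q → - (p - q) ≡ q - p
-[p-q]≡q-p = solve-∀ ring

∣p-q∣≡∣q-p∣ : ∀ p q → ∣ p - q ∣ ≡ ∣ q - p ∣
∣p-q∣≡∣q-p∣ p q = trans (sym (∣-p∣≡∣p∣ (p - q))) (cong ∣_∣ (-[p-q]≡q-p p q))

p≤r+q⇒r≤s⇒p-s≤q : ∀ {p q r s} → p ≤ r + q → r ≤ s → p - s ≤ q
p≤r+q⇒r≤s⇒p-s≤q {p} {q} {r} {s} p≤r+q r≤s = begin
  p - s      ≤⟨ +-mono-≤ p≤r+q (neg-antimono-≤ r≤s) ⟩
  r + q - r  ≡⟨ solve (r ∷ q ∷ []) ring ⟩
  q          ∎

∣-∣≤-interval : ∀ {c w x y} → c ≤ x → x ≤ c + w → c ≤ y → y ≤ c + w → ∣ x - y ∣ ≤ w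
∣-∣≤-interval {c} {w} {x} {y} c≤x x≤c+w c≤y y≤c+w with ∣p∣≡p∨∣p∣≡-p (x - y)
... | inj₁ ∣x-y∣≡x-y = subst (_≤ w) (sym ∣x-y∣≡x-y) (p≤r+q⇒r≤s⇒p-s≤q x≤c+w c≤y)
... | inj₂ ∣x-y∣≡y-x = subst (_≤ w) (sym (trans ∣x-y∣≡y-x (-[p-q]≡q-p x y)))
                         (p≤r+q⇒r≤s⇒p-s≤q y≤c+w c≤x)

gap≤∣-∣ : ∀ {c g x y} → x ≤ c → c + g ≤ y → g ≤ ∣ y - x ∣
gap≤∣-∣ {c} {g} {x} {y} x≤c c+g≤y =
  ≤-trans (p+q≤r⇒q≤r-p (≤-trans (+-monoˡ-≤ g x≤c) c+g≤y)) (p≤∣p∣ (y - x))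

-- From (1 - t)A + tB = 0 one gets (1 - t)|A| = t|B|, and then
-- (|A| + |B|)((1 - t)P + tQ) = |P||B| - |A||Q|.
convex-combination-pos : ∀ {t A B P Q} → 0ℚ ≤ t → t ≤ 1ℚ → (1ℚ - t) * A + t * B ≡ 0ℚ →
                         0ℚ < P → Q < 0ℚ → ∣ A ∣ * ∣ Q ∣ < ∣ P ∣ * ∣ B ∣ →
                         0ℚ < (1ℚ - t) * P + t * Q
convex-combination-pos {t} {A} {B} {P} {Q} 0≤t t≤1 combination≡0 0<P Q<0 ratio =
  *-cancelˡ-<-nonNeg (∣ A ∣ + ∣ B ∣) {{nonNegative (+-nonNeg (0≤∣p∣ A) (0≤∣p∣ B))}}
    (begin-strict
      (∣ A ∣ + ∣ B ∣) * 0ℚ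
        ≡⟨ *-zeroʳ (∣ A ∣ + ∣ B ∣) ⟩
      0ℚ
        <⟨ p<q⇒0<q-p ratio ⟩
      ∣ P ∣ * ∣ B ∣ - ∣ A ∣ * ∣ Q ∣
        ≡⟨ cong₂ (λ p q → p * ∣ B ∣ - ∣ A ∣ * q) (0≤p⇒∣p∣≡p (<⇒≤ 0<P)) (p≤0⇒∣p∣≡-p (<⇒≤ Q<0)) ⟩
      P * ∣ B ∣ - ∣ A ∣ * (- Q)
        ≡⟨ rebalance balance ⟩
      (∣ A ∣ + ∣ B ∣) * ((1ℚ - t) * P + t * Q) ∎)
  where
  balance : (1ℚ - t) * ∣ A ∣ ≡ t * ∣ B ∣
  balance = begin-equality
    (1ℚ - t) * ∣ A ∣    ≡⟨ cong (_* ∣ A ∣) (0≤p⇒∣p∣≡p (p≤q⇒0≤q-p t≤1)) ⟨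
    ∣ 1ℚ - t ∣ * ∣ A ∣  ≡⟨ ∣p*q∣≡∣p∣*∣q∣ (1ℚ - t) A ⟨
    ∣ (1ℚ - t) * A ∣    ≡⟨ cong ∣_∣ (inverseˡ-unique _ _ combination≡0) ⟩
    ∣ - (t * B) ∣       ≡⟨ ∣-p∣≡∣p∣ (t * B) ⟩
    ∣ t * B ∣           ≡⟨ ∣p*q∣≡∣p∣*∣q∣ t B ⟩
    ∣ t ∣ * ∣ B ∣       ≡⟨ cong (_* ∣ B ∣) (0≤p⇒∣p∣≡p 0≤t) ⟩
    t * ∣ B ∣           ∎
  rebalance : ∀ {a b} → (1ℚ - t) * a ≡ t * b →
              P * b - a * (- Q) ≡ (a + b) * ((1ℚ - t) * P + t * Q)
  rebalance {a} {b} e = begin-equality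
    P * b - a * (- Q)
      ≡⟨ solve (t ∷ a ∷ b ∷ P ∷ Q ∷ []) ring ⟩
    t * b * P + (1ℚ - t) * b * P + t * a * Q + (1ℚ - t) * a * Q
      ≡⟨ cong₂ (λ u v → u * P + (1ℚ - t) * b * P + t * a * Q + v * Q) (sym e) e ⟩
    (1ℚ - t) * a * P + (1ℚ - t) * b * P + t * a * Q + t * b * Q
      ≡⟨ solve (t ∷ a ∷ b ∷ P ∷ Q ∷ []) ring ⟩
    (a + b) * ((1ℚ - t) * P + t * Q) ∎

-- Orientation along segments and in convex drawings

orient-rotate : ∀ P Q R → orient P Q R ≡ orient Q R P
orient-rotate (px , py) (qx , qy) (rx , ry) = rotation px py qx qy rx ry
  where
  rotation : ∀ px py qx qy rx ry →
    (qx - px) * (ry - py) - (qy - py) * (rx - px) ≡ (rx - qx) * (py - qy) - (ry - qy) * (px - qx)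
  rotation = solve-∀ ring

orient-swap : ∀ P Q R → orient P R Q ≡ - orient P Q R
orient-swap (px , py) (qx , qy) (rx , ry) = swap px py qx qy rx ry
  where
  swap : ∀ px py qx qy rx ry →
    (rx - px) * (qy - py) - (ry - py) * (qx - px) ≡ - ((qx - px) * (ry - py) - (qy - py) * (rx - px))
  swap = solve-∀ ring

lerp : Point → Point → ℚ → Point
lerp (px , py) (qx , qy) t = (px + t * (qx - px) , py + t * (qy - py))

orient-lerp : ∀ U V P Q t → orient U V (lerp P Q t) ≡ (1ℚ - t) * orient U V P + t * orient U V Q
orient-lerp (ux , uy) (vx , vy) (px , py) (qx , qy) t = affine ux uy vx vy px py qx qy t
  where
  affine : ∀ ux uy vx vy px py qx qy t →
    (vx - ux) * (py + t * (qy - py) - uy) - (vy - uy) * (px + t * (qx - px) - ux)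
      ≡ (1ℚ - t) * ((vx - ux) * (py - uy) - (vy - uy) * (px - ux))
        + t * ((vx - ux) * (qy - uy) - (vy - uy) * (qx - ux))
  affine = solve-∀ ring

orient-lerp-collinear : ∀ P Q t → orient P Q (lerp P Q t) ≡ 0ℚ
orient-lerp-collinear (px , py) (qx , qy) t = collinear px py qx qy t
  where
  collinear : ∀ px py qx qy t →
    (qx - px) * (py + t * (qy - py) - py) - (qy - py) * (px + t * (qx - px) - px) ≡ 0ℚ
  collinear = solve-∀ ring

lerp-reverse : ∀ P Q t → lerp P Q t ≡ lerp Q P (1ℚ - t)
lerp-reverse (px , py) (qx , qy) t = cong₂ _,_ (flip px qx t) (flip py qy t)
  where
  flip : ∀ p q t → p + t * (q - p) ≡ q + (1ℚ - t) * (p - q)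
  flip = solve-∀ ring

OnSegment-reverse : ∀ {x} P Q → OnSegment x P Q → OnSegment x Q P
OnSegment-reverse P Q (t , 0≤t , t≤1 , x≡) =
  1ℚ - t , p≤q⇒0≤q-p t≤1 , +-monoʳ-≤ 1ℚ (neg-antimono-≤ 0≤t) , trans x≡ (lerp-reverse P Q t)

OnSegment⇒collinear : ∀ {x} P Q → OnSegment x P Q → orient P Q x ≡ 0ℚ
OnSegment⇒collinear P Q (t , _ , _ , refl) = orient-lerp-collinear P Q t

OnSegment⇒orient-affine : ∀ {x} P Q → OnSegment x P Q →
  Σ ℚ λ t → 0ℚ ≤ t × t ≤ 1ℚ × (∀ U V → orient U V x ≡ (1ℚ - t) * orient U V P + t * orient U V Q)
OnSegment⇒orient-affine P Q (t , 0≤t , t≤1 , refl) =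
  t , 0≤t , t≤1 , λ U V → orient-lerp U V P Q t

-- x divides AB in the ratio |orient C D A| : |orient C D B| and the line IJ
-- divides it in the ratio |orient I J A| : |orient I J B|; the last hypothesis
-- says that x is the nearer of the two to A.
crossing-side : ∀ {x} A B C D I J → OnSegment x A B → orient C D x ≡ 0ℚ →
                0ℚ < orient I J A → orient I J B < 0ℚ →
                ∣ orient C D A ∣ * ∣ orient I J B ∣ < ∣ orient I J A ∣ * ∣ orient C D B ∣ →
                0ℚ < orient I J x
crossing-side A B C D I J x∈AB CDx≡0 0<IJA IJB<0 ratio =
  let t , 0≤t , t≤1 , affine = OnSegment⇒orient-affine A B x∈AB
  in subst (0ℚ <_) (sym (affine I J))
       (convex-combination-pos {A = orient C D A} {orient C D B}
         0≤t t≤1 (trans (sym (affine C D)) CDx≡0) 0<IJA IJB<0 ratio)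

RightSide : ∀ {n} → Fin n → Fin n → Fin n → Set
RightSide i j r = toℕ i ℕ.< toℕ r × toℕ r ℕ.< toℕ j

leftSide-orient-pos : ∀ {n} (Γ : ConvexDrawing n) {i j l} → toℕ i ℕ.< toℕ j → LeftSide i j l →
                      0ℚ < orient (pos Γ i) (pos Γ j) (pos Γ l)
leftSide-orient-pos Γ {i} {j} {l} i<j (inj₁ l<i) =
  subst (0ℚ <_) (orient-rotate (pos Γ l) (pos Γ i) (pos Γ j)) (ccw Γ l i j l<i i<j)
leftSide-orient-pos Γ {i} {j} {l} i<j (inj₂ j<l) = ccw Γ i j l i<j j<l

rightSide-orient-neg : ∀ {n} (Γ : ConvexDrawing n) {i j r} → RightSide i j r →
                       orient (pos Γ i) (pos Γ j) (pos Γ r) < 0ℚ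
rightSide-orient-neg Γ {i} {j} {r} (i<r , r<j) =
  subst (_< 0ℚ) (sym (orient-swap (pos Γ i) (pos Γ r) (pos Γ j)))
    (neg-antimono-< (ccw Γ i r j i<r r<j))

Alternating : ∀ {n} → Fin n → Fin n → Fin n → Fin n → Set
Alternating a b c d = toℕ a ℕ.< toℕ b × toℕ b ℕ.< toℕ c × toℕ c ℕ.< toℕ d

intertwined⇒alternating : ∀ {n} {a b c d : Fin n} → Intertwined a b c d →
                          Alternating a c b d ⊎ Alternating c a d b
intertwined⇒alternating h = ⊎-map chain chain (Equivalence.to T-∨ (Equivalence.from T-≡ h))
  where
  ltᵇ⇒< : ∀ {n} {x y : Fin n} → T (ltᵇ x y) → toℕ x ℕ.< toℕ y
  ltᵇ⇒< {x = x} {y} = ℕₚ.<ᵇ⇒< (toℕ x) (toℕ y)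
  chain : ∀ {n} {x y z w : Fin n} → T (ltᵇ x y ∧ (ltᵇ y z ∧ ltᵇ z w)) → Alternating x y z w
  chain h with x<y , h′ ← Equivalence.to T-∧ h with y<z , z<w ← Equivalence.to T-∧ h′ =
    ltᵇ⇒< x<y , ltᵇ⇒< y<z , ltᵇ⇒< z<w

pierced⇒sides : ∀ {n} {a b i j : Fin n} → Intertwined a b i j →
                (LeftSide i j a × RightSide i j b) ⊎ (RightSide i j a × LeftSide i j b)
pierced⇒sides h with intertwined⇒alternating h
... | inj₁ (a<i , i<b , b<j) = inj₁ (inj₁ a<i , i<b , b<j)
... | inj₂ (i<a , a<j , j<b) = inj₂ ((i<a , a<j) , inj₂ j<b)

intertwined⇒disjoint : ∀ {n} {a b c d : Fin n} → Intertwined a b c d →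
  toℕ a ≢ toℕ c × toℕ a ≢ toℕ d × toℕ b ≢ toℕ c × toℕ b ≢ toℕ d
intertwined⇒disjoint h with intertwined⇒alternating h
... | inj₁ (a<c , c<b , b<d) =
  ℕₚ.<⇒≢ a<c , ℕₚ.<⇒≢ (ℕₚ.<-trans a<c (ℕₚ.<-trans c<b b<d)) , ℕₚ.>⇒≢ c<b , ℕₚ.<⇒≢ b<d
... | inj₂ (c<a , a<d , d<b) =
  ℕₚ.>⇒≢ c<a , ℕₚ.<⇒≢ a<d , ℕₚ.>⇒≢ (ℕₚ.<-trans c<a (ℕₚ.<-trans a<d d<b)) , ℕₚ.>⇒≢ d<b

-- Rational points of the unit circle

1+s²-positive : ∀ s → Positive (1ℚ + s * s)
1+s²-positive s = positive (+-mono-<-≤ (positive⁻¹ 1ℚ) (square-nonNeg s))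

weight : ℚ → ℚ
weight s = (1/ (1ℚ + s * s)) {{pos⇒nonZero (1ℚ + s * s) {{1+s²-positive s}}}}

weight-inverse : ∀ s → weight s * (1ℚ + s * s) ≡ 1ℚ
weight-inverse s = *-inverseˡ (1ℚ + s * s) {{pos⇒nonZero (1ℚ + s * s) {{1+s²-positive s}}}}

weight-pos : ∀ s → 0ℚ < weight s
weight-pos s = positive⁻¹ (weight s) {{1/pos⇒pos (1ℚ + s * s) {{1+s²-positive s}}}}

-- The first coordinate (1 - s²)/(1 + s²) is written as 2/(1 + s²) - 1.
circlePoint : ℚ → Point
circlePoint s = (2 * weight s - 1ℚ , 2 * s * weight s)

circlePoint-onUnitCircle : ∀ s →
  sq (proj₁ (circlePoint s) - 0ℚ) + sq (proj₂ (circlePoint s) - 0ℚ) ≡ 1ℚ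
circlePoint-onUnitCircle s = onUnitCircle s (weight s) (weight-inverse s)
  where
  onUnitCircle : ∀ s w → w * (1ℚ + s * s) ≡ 1ℚ →
                 sq ((2 * w - 1ℚ) - 0ℚ) + sq (2 * s * w - 0ℚ) ≡ 1ℚ
  onUnitCircle s w w-inverse = begin-equality
    (2 * w - 1ℚ - 0ℚ) * (2 * w - 1ℚ - 0ℚ) + (2 * s * w - 0ℚ) * (2 * s * w - 0ℚ)
      ≡⟨ solve (s ∷ w ∷ []) ring ⟩
    4 * w * (w * (1ℚ + s * s) - 1ℚ) + 1ℚ
      ≡⟨ cong (λ e → 4 * w * (e - 1ℚ) + 1ℚ) w-inverse ⟩
    4 * w * (1ℚ - 1ℚ) + 1ℚ
      ≡⟨ solve (w ∷ []) ring ⟩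
    1ℚ ∎

-- The point determines s as the slope of the line through (-1, 0): y = s (x + 1).
circlePoint-<⇒≢ : ∀ {s s′} → s < s′ → circlePoint s ≢ circlePoint s′
circlePoint-<⇒≢ {s} {s′} s<s′ eq = <-irrefl (cong proj₂ eq) (begin-strict
  proj₂ (circlePoint s)               ≡⟨ slope s ⟩
  s * (proj₁ (circlePoint s) + 1ℚ)    <⟨ *-monoˡ-<-pos _ {{positive (x+1-pos s)}} s<s′ ⟩
  s′ * (proj₁ (circlePoint s) + 1ℚ)   ≡⟨ cong (λ p → s′ * (proj₁ p + 1ℚ)) eq ⟩
  s′ * (proj₁ (circlePoint s′) + 1ℚ)  ≡⟨ slope s′ ⟨
  proj₂ (circlePoint s′)              ∎)
  where
  slope-identity : ∀ s w → 2 * s * w ≡ s * ((2 * w - 1ℚ) + 1ℚ)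
  slope-identity = solve-∀ ring
  slope : ∀ s → proj₂ (circlePoint s) ≡ s * (proj₁ (circlePoint s) + 1ℚ)
  slope s = slope-identity s (weight s)
  shift-identity : ∀ w → 2 * w ≡ (2 * w - 1ℚ) + 1ℚ
  shift-identity = solve-∀ ring
  x+1-pos : ∀ s → 0ℚ < proj₁ (circlePoint s) + 1ℚ
  x+1-pos s = subst (0ℚ <_) (shift-identity (weight s)) (*-pos (positive⁻¹ 2) (weight-pos s))

κ : ℚ → ℚ → ℚ → ℚ
κ a b c = 4 * (weight a * weight b * weight c)

κ-pos : ∀ a b c → 0ℚ < κ a b c
κ-pos a b c = *-pos (positive⁻¹ 4) (*-pos (*-pos (weight-pos a) (weight-pos b)) (weight-pos c))

-- orient is 4 Σ wₐ w_b (b - a) over the cyclic pairs; writing each missing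
-- factor 1 as w_c (1 + c²) exposes the Vandermonde product.
orient-circlePoint : ∀ a b c →
  orient (circlePoint a) (circlePoint b) (circlePoint c) ≡ κ a b c * ((b - a) * (c - a) * (c - b))
orient-circlePoint a b c =
  orient-circle a b c (weight a) (weight b) (weight c) (weight-inverse a) (weight-inverse b) (weight-inverse c)
  where
  orient-circle : ∀ a b c wa wb wc →
    wa * (1ℚ + a * a) ≡ 1ℚ → wb * (1ℚ + b * b) ≡ 1ℚ → wc * (1ℚ + c * c) ≡ 1ℚ →
    orient (2 * wa - 1ℚ , 2 * a * wa) (2 * wb - 1ℚ , 2 * b * wb) (2 * wc - 1ℚ , 2 * c * wc)
      ≡ 4 * (wa * wb * wc) * ((b - a) * (c - a) * (c - b))
  orient-circle a b c wa wb wc ea eb ec = begin-equality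
    (2 * wb - 1ℚ - (2 * wa - 1ℚ)) * (2 * c * wc - 2 * a * wa)
      - (2 * b * wb - 2 * a * wa) * (2 * wc - 1ℚ - (2 * wa - 1ℚ))
      ≡⟨ solve (a ∷ b ∷ c ∷ wa ∷ wb ∷ wc ∷ []) ring ⟩
    4 * (wa * wb * 1ℚ * (b - a) + wb * wc * 1ℚ * (c - b) + wc * wa * 1ℚ * (a - c))
      ≡⟨ cong (λ (ea , eb , ec) →
                 4 * (wa * wb * ec * (b - a) + wb * wc * ea * (c - b) + wc * wa * eb * (a - c)))
              (sym (cong₂ _,_ ea (cong₂ _,_ eb ec))) ⟩
    4 * (wa * wb * (wc * (1ℚ + c * c)) * (b - a) + wb * wc * (wa * (1ℚ + a * a)) * (c - b)
         + wc * wa * (wb * (1ℚ + b * b)) * (a - c))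
      ≡⟨ solve (a ∷ b ∷ c ∷ wa ∷ wb ∷ wc ∷ []) ring ⟩
    4 * (wa * wb * wc) * ((b - a) * (c - a) * (c - b)) ∎

orient-circlePoint-pos : ∀ {a b c} → a < b → b < c →
                         0ℚ < orient (circlePoint a) (circlePoint b) (circlePoint c)
orient-circlePoint-pos {a} {b} {c} a<b b<c =
  subst (0ℚ <_) (sym (orient-circlePoint a b c))
    (*-pos (κ-pos a b c) (*-pos (*-pos (p<q⇒0<q-p a<b) (p<q⇒0<q-p (<-trans a<b b<c))) (p<q⇒0<q-p b<c)))

∣orient-circlePoint∣ : ∀ a b c → ∣ orient (circlePoint a) (circlePoint b) (circlePoint c) ∣
                                 ≡ κ a b c * (∣ b - a ∣ * ∣ c - a ∣ * ∣ c - b ∣)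
∣orient-circlePoint∣ a b c = begin-equality
  ∣ orient (circlePoint a) (circlePoint b) (circlePoint c) ∣
    ≡⟨ cong ∣_∣ (orient-circlePoint a b c) ⟩
  ∣ κ a b c * ((b - a) * (c - a) * (c - b)) ∣
    ≡⟨ ∣p*q∣≡∣p∣*∣q∣ (κ a b c) ((b - a) * (c - a) * (c - b)) ⟩
  ∣ κ a b c ∣ * ∣ (b - a) * (c - a) * (c - b) ∣
    ≡⟨ cong₂ _*_ (0≤p⇒∣p∣≡p (<⇒≤ (κ-pos a b c)))
                 (trans (∣p*q∣≡∣p∣*∣q∣ ((b - a) * (c - a)) (c - b))
                        (cong (_* ∣ c - b ∣) (∣p*q∣≡∣p∣*∣q∣ (b - a) (c - a)))) ⟩
  κ a b c * (∣ b - a ∣ * ∣ c - a ∣ * ∣ c - b ∣) ∎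

circlePoint-crossing-ratio : ∀ a b c d i j → 0ℚ < ∣ d - c ∣ → 0ℚ < ∣ j - i ∣ →
  ∣ a - c ∣ * ∣ a - d ∣ * (∣ b - i ∣ * ∣ b - j ∣) < ∣ a - i ∣ * ∣ a - j ∣ * (∣ b - c ∣ * ∣ b - d ∣) →
  ∣ orient (circlePoint c) (circlePoint d) (circlePoint a) ∣
    * ∣ orient (circlePoint i) (circlePoint j) (circlePoint b) ∣
  < ∣ orient (circlePoint i) (circlePoint j) (circlePoint a) ∣
    * ∣ orient (circlePoint c) (circlePoint d) (circlePoint b) ∣
circlePoint-crossing-ratio a b c d i j 0<∣d-c∣ 0<∣j-i∣ parameters =
  subst₂ _<_ (sym (split c d a i j b))
             (sym (trans (split i j a c d b) (cong (_* right) (sym common-factor))))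
             (*-monoʳ-<-pos factor {{positive factor-pos}} parameters)
  where
  regroup : ∀ k l e x y f z u → k * (e * x * y) * (l * (f * z * u)) ≡ k * l * (e * f) * (x * y * (z * u))
  regroup = solve-∀ ring
  split : ∀ x y z u v w →
    ∣ orient (circlePoint x) (circlePoint y) (circlePoint z) ∣
      * ∣ orient (circlePoint u) (circlePoint v) (circlePoint w) ∣
    ≡ κ x y z * κ u v w * (∣ y - x ∣ * ∣ v - u ∣) * (∣ z - x ∣ * ∣ z - y ∣ * (∣ w - u ∣ * ∣ w - v ∣))
  split x y z u v w = trans (cong₂ _*_ (∣orient-circlePoint∣ x y z) (∣orient-circlePoint∣ u v w))
    (regroup (κ x y z) (κ u v w) (∣ y - x ∣) (∣ z - x ∣) (∣ z - y ∣) (∣ v - u ∣) (∣ w - u ∣) (∣ w - v ∣))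
  commute : ∀ wa wb wc wd wi wj e f →
    4 * (wc * wd * wa) * (4 * (wi * wj * wb)) * (e * f)
      ≡ 4 * (wi * wj * wa) * (4 * (wc * wd * wb)) * (f * e)
  commute = solve-∀ ring
  factor right : ℚ
  factor = κ c d a * κ i j b * (∣ d - c ∣ * ∣ j - i ∣)
  right  = ∣ a - i ∣ * ∣ a - j ∣ * (∣ b - c ∣ * ∣ b - d ∣)
  common-factor : factor ≡ κ i j a * κ c d b * (∣ j - i ∣ * ∣ d - c ∣)
  common-factor =
    commute (weight a) (weight b) (weight c) (weight d) (weight i) (weight j) (∣ d - c ∣) (∣ j - i ∣)
  factor-pos : 0ℚ < factor
  factor-pos = *-pos (*-pos (κ-pos c d a) (κ-pos i j b)) (*-pos 0<∣d-c∣ 0<∣j-i∣)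

circleDrawing : ∀ {n} (s : Fin n → ℚ) → (∀ {u v} → toℕ u ℕ.< toℕ v → s u < s v) → ConvexDrawing n
circleDrawing s s-increasing = record
  { center   = 0ℚ , 0ℚ
  ; radius²  = 1ℚ
  ; radius>0 = positive⁻¹ 1ℚ
  ; pos      = circlePoint ∘ s
  ; onCircle = circlePoint-onUnitCircle ∘ s
  ; distinct = distinct-points
  ; ccw      = λ _ _ _ u<v v<w → orient-circlePoint-pos (s-increasing u<v) (s-increasing v<w)
  }
  where
  distinct-points : ∀ u v → u ≢ v → circlePoint (s u) ≢ circlePoint (s v)
  distinct-points u v u≢v with ℕₚ.<-cmp (toℕ u) (toℕ v)
  ... | tri< u<v _ _ = circlePoint-<⇒≢ (s-increasing u<v)
  ... | tri≈ _ u≡v _ = contradiction (toℕ-injective u≡v) u≢v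
  ... | tri> _ _ v<u = circlePoint-<⇒≢ (s-increasing v<u) ∘ sym

-- The clustered drawing

fromℕ : ℕ → ℚ
fromℕ zero    = 0ℚ
fromℕ (suc m) = 1ℚ + fromℕ m

fromℕ-nonNeg : ∀ m → 0ℚ ≤ fromℕ m
fromℕ-nonNeg zero    = ≤-refl
fromℕ-nonNeg (suc m) = +-nonNeg (nonNegative⁻¹ 1ℚ) (fromℕ-nonNeg m)

fromℕ-mono-≤ : ∀ {m m′} → m ℕ.≤ m′ → fromℕ m ≤ fromℕ m′
fromℕ-mono-≤ {m′ = m′} z≤n = fromℕ-nonNeg m′
fromℕ-mono-≤ (s≤s m≤m′)     = +-monoʳ-≤ 1ℚ (fromℕ-mono-≤ m≤m′)

step : ℚ → ℕ → ℕ → ℚ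
step h t m with t ℕ.≤? m
... | yes _ = h
... | no _  = 0ℚ

step-on : ∀ h {t m} → t ℕ.≤ m → step h t m ≡ h
step-on h {t} {m} t≤m with t ℕ.≤? m
... | yes _   = refl
... | no t≰m = contradiction t≤m t≰m

step-off : ∀ h {t m} → m ℕ.< t → step h t m ≡ 0ℚ
step-off h {t} {m} m<t with t ℕ.≤? m
... | yes t≤m = contradiction m<t (ℕₚ.≤⇒≯ t≤m)
... | no _    = refl

step-mono : ∀ {h} t {m m′} → 0ℚ ≤ h → m ℕ.≤ m′ → step h t m ≤ step h t m′
step-mono t {m} {m′} 0≤h m≤m′ with t ℕ.≤? m | t ℕ.≤? m′
... | yes _   | yes _   = ≤-refl
... | yes t≤m | no t≰m′ = contradiction (ℕₚ.≤-trans t≤m m≤m′) t≰m′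
... | no _    | yes _   = 0≤h
... | no _    | no _    = ≤-refl

step-bounds : ∀ {h} t m → 0ℚ ≤ h → 0ℚ ≤ step h t m × step h t m ≤ h
step-bounds t m 0≤h with t ℕ.≤? m
... | yes _ = 0≤h , ≤-refl
... | no _  = ≤-refl , 0≤h

-- g³ - R²N² = 9N⁴(3N - 1)(15N + 1), written with N - 1 ≥ 0.
cube-dominates : ∀ {N} → 1ℚ ≤ N →
  let g = 9 * (N * N)
      R = 3 * N + 2 * g
  in R * R * (N * N) < g * g * (g * 1ℚ)
cube-dominates {N} 1≤N =
  let g = 9 * (N * N)
      R = 3 * N + 2 * g
  in begin-strict
    R * R * (N * N)
      <⟨ p<p+q excess-pos ⟩
    R * R * (N * N) + 9 * (N * N * (N * N)) * ((3 * (N - 1ℚ) + 2) * (15 * (N - 1ℚ) + 16))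
      ≡⟨ solve (N ∷ []) ring ⟩
    g * g * (g * 1ℚ) ∎
  where
  0<N : 0ℚ < N
  0<N = <-≤-trans (positive⁻¹ 1ℚ) 1≤N
  0≤N-1 : 0ℚ ≤ N - 1ℚ
  0≤N-1 = p≤q⇒0≤q-p 1≤N
  affine-pos : ∀ {α β} → 0ℚ ≤ α → 0ℚ < β → 0ℚ < α * (N - 1ℚ) + β
  affine-pos 0≤α 0<β = +-nonNeg-pos (*-nonNeg 0≤α 0≤N-1) 0<β
  excess-pos : 0ℚ < 9 * (N * N * (N * N)) * ((3 * (N - 1ℚ) + 2) * (15 * (N - 1ℚ) + 16))
  excess-pos = *-pos (*-pos (positive⁻¹ 9) (*-pos (*-pos 0<N 0<N) (*-pos 0<N 0<N)))
                     (*-pos (affine-pos (nonNegative⁻¹ 3) (positive⁻¹ 2))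
                            (affine-pos (nonNegative⁻¹ 15) (positive⁻¹ 16)))

-- Vertices before vᵢ get
-- parameters in [0, N], the closed arc vᵢ … vⱼ gets [K, K + N] and the vertices
-- after vⱼ get [2K, 2K + N], so the arc is a cluster of width N at distance at
-- least gap from the left side.  Every parameter lies in [0, R]; gap = 9N²
-- makes R²N² < gap³, which bounds the two sides of key-inequality.
module Clustered {n : ℕ} (i j : Fin n) (i<j : toℕ i ℕ.< toℕ j) where

  N gap K R : ℚ
  N   = fromℕ n
  gap = 9 * (N * N)
  K   = N + gap
  R   = N + K + K

  σ : Fin n → ℚ
  σ v = fromℕ (toℕ v) + step K (toℕ i) (toℕ v) + step K (suc (toℕ j)) (toℕ v)

  Arc : Fin n → Set
  Arc v = toℕ i ℕ.≤ toℕ v × toℕ v ℕ.≤ toℕ j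

  rightSide⇒arc : ∀ {v} → RightSide i j v → Arc v
  rightSide⇒arc (i<v , v<j) = ℕₚ.<⇒≤ i<v , ℕₚ.<⇒≤ v<j

  i∈arc : Arc i
  i∈arc = ℕₚ.≤-refl , ℕₚ.<⇒≤ i<j

  j∈arc : Arc j
  j∈arc = ℕₚ.<⇒≤ i<j , ℕₚ.≤-refl

  1≤N : 1ℚ ≤ N
  1≤N = fromℕ-mono-≤ (ℕₚ.≤-trans (s≤s z≤n) (toℕ<n i))

  0<N : 0ℚ < N
  0<N = <-≤-trans (positive⁻¹ 1ℚ) 1≤N

  0≤N : 0ℚ ≤ N
  0≤N = <⇒≤ 0<N

  0≤gap : 0ℚ ≤ gap
  0≤gap = *-nonNeg (nonNegative⁻¹ 9) (square-nonNeg N)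

  0<gap : 0ℚ < gap
  0<gap = *-pos (positive⁻¹ 9) (*-pos 0<N 0<N)

  0≤K : 0ℚ ≤ K
  0≤K = +-nonNeg 0≤N 0≤gap

  fromℕ≤N : ∀ (v : Fin n) → fromℕ (toℕ v) ≤ N
  fromℕ≤N v = fromℕ-mono-≤ (ℕₚ.<⇒≤ (toℕ<n v))

  σ-increasing : ∀ {u v} → toℕ u ℕ.< toℕ v → σ u + 1ℚ ≤ σ v
  σ-increasing {u} {v} u<v = begin
    σ u + 1ℚ
      ≡⟨ move-one (fromℕ (toℕ u)) (step K (toℕ i) (toℕ u)) (step K (suc (toℕ j)) (toℕ u)) ⟩
    fromℕ (suc (toℕ u)) + step K (toℕ i) (toℕ u) + step K (suc (toℕ j)) (toℕ u)
      ≤⟨ +-mono-≤ (+-mono-≤ (fromℕ-mono-≤ u<v) (step-mono (toℕ i) 0≤K (ℕₚ.<⇒≤ u<v)))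
                   (step-mono (suc (toℕ j)) 0≤K (ℕₚ.<⇒≤ u<v)) ⟩
    σ v ∎
    where
    move-one : ∀ a b c → a + b + c + 1ℚ ≡ 1ℚ + a + b + c
    move-one = solve-∀ ring

  σ-< : ∀ {u v} → toℕ u ℕ.< toℕ v → σ u < σ v
  σ-< u<v = <-≤-trans (p<p+q (positive⁻¹ 1ℚ)) (σ-increasing u<v)

  σ-separated : ∀ {u v} → toℕ u ≢ toℕ v → 1ℚ ≤ ∣ σ u - σ v ∣
  σ-separated {u} {v} u≢v with ℕₚ.<-cmp (toℕ u) (toℕ v)
  ... | tri< u<v _ _ = subst (1ℚ ≤_) (∣p-q∣≡∣q-p∣ (σ v) (σ u))
                         (≤-trans (p+q≤r⇒q≤r-p (σ-increasing u<v)) (p≤∣p∣ _))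
  ... | tri≈ _ u≡v _ = contradiction u≡v u≢v
  ... | tri> _ _ v<u = ≤-trans (p+q≤r⇒q≤r-p (σ-increasing v<u)) (p≤∣p∣ _)

  σ-range : ∀ u v → ∣ σ u - σ v ∣ ≤ R
  σ-range u v = ∣-∣≤-interval (σ-nonNeg u) (≤R u) (σ-nonNeg v) (≤R v)
    where
    bounds₁ : ∀ (v : Fin n) → 0ℚ ≤ step K (toℕ i) (toℕ v) × step K (toℕ i) (toℕ v) ≤ K
    bounds₁ v = step-bounds (toℕ i) (toℕ v) 0≤K
    bounds₂ : ∀ (v : Fin n) → 0ℚ ≤ step K (suc (toℕ j)) (toℕ v) × step K (suc (toℕ j)) (toℕ v) ≤ K
    bounds₂ v = step-bounds (suc (toℕ j)) (toℕ v) 0≤K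
    σ-nonNeg : ∀ v → 0ℚ ≤ σ v
    σ-nonNeg v = +-nonNeg (+-nonNeg (fromℕ-nonNeg (toℕ v)) (proj₁ (bounds₁ v))) (proj₁ (bounds₂ v))
    ≤R : ∀ v → σ v ≤ 0ℚ + R
    ≤R v = subst (σ v ≤_) (sym (+-identityˡ R))
             (+-mono-≤ (+-mono-≤ (fromℕ≤N v) (proj₂ (bounds₁ v))) (proj₂ (bounds₂ v)))

  σ-before : ∀ {v} → toℕ v ℕ.< toℕ i → σ v ≡ fromℕ (toℕ v)
  σ-before {v} v<i = begin-equality
    σ v
      ≡⟨ cong₂ (λ x y → fromℕ (toℕ v) + x + y)
               (step-off K v<i) (step-off K (ℕₚ.<-trans v<i (ℕₚ.<-trans i<j (ℕₚ.n<1+n (toℕ j))))) ⟩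
    fromℕ (toℕ v) + 0ℚ + 0ℚ
      ≡⟨ drop-zeros (fromℕ (toℕ v)) ⟩
    fromℕ (toℕ v) ∎
    where
    drop-zeros : ∀ a → a + 0ℚ + 0ℚ ≡ a
    drop-zeros = solve-∀ ring

  σ-arc : ∀ {v} → Arc v → σ v ≡ K + fromℕ (toℕ v)
  σ-arc {v} (i≤v , v≤j) = begin-equality
    σ v
      ≡⟨ cong₂ (λ x y → fromℕ (toℕ v) + x + y) (step-on K i≤v) (step-off K (s≤s v≤j)) ⟩
    fromℕ (toℕ v) + K + 0ℚ
      ≡⟨ reorder (fromℕ (toℕ v)) K ⟩
    K + fromℕ (toℕ v) ∎
    where
    reorder : ∀ a b → a + b + 0ℚ ≡ b + a
    reorder = solve-∀ ring

  σ-after : ∀ {v} → toℕ j ℕ.< toℕ v → σ v ≡ K + K + fromℕ (toℕ v)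
  σ-after {v} j<v = begin-equality
    σ v
      ≡⟨ cong₂ (λ x y → fromℕ (toℕ v) + x + y) (step-on K (ℕₚ.<⇒≤ (ℕₚ.<-trans i<j j<v))) (step-on K j<v) ⟩
    fromℕ (toℕ v) + K + K
      ≡⟨ reorder (fromℕ (toℕ v)) K ⟩
    K + K + fromℕ (toℕ v) ∎
    where
    reorder : ∀ a b → a + b + b ≡ b + b + a
    reorder = solve-∀ ring

  σ-arc-bounds : ∀ {v} → Arc v → K ≤ σ v × σ v ≤ K + N
  σ-arc-bounds {v} v∈arc rewrite σ-arc v∈arc =
    p≤p+q (fromℕ-nonNeg (toℕ v)) , +-monoʳ-≤ K (fromℕ≤N v)

  arc-width : ∀ {u v} → Arc u → Arc v → ∣ σ u - σ v ∣ ≤ N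
  arc-width u∈arc v∈arc =
    let K≤σu , σu≤K+N = σ-arc-bounds u∈arc
        K≤σv , σv≤K+N = σ-arc-bounds v∈arc
    in ∣-∣≤-interval K≤σu σu≤K+N K≤σv σv≤K+N

  left-arc-gap : ∀ {l m} → LeftSide i j l → Arc m → gap ≤ ∣ σ l - σ m ∣
  left-arc-gap {l} {m} (inj₁ l<i) m∈arc =
    subst (gap ≤_) (∣p-q∣≡∣q-p∣ (σ m) (σ l))
      (gap≤∣-∣ (subst (_≤ N) (sym (σ-before l<i)) (fromℕ≤N l)) (proj₁ (σ-arc-bounds m∈arc)))
  left-arc-gap {l} {m} (inj₂ j<l) m∈arc =
    gap≤∣-∣ (proj₂ (σ-arc-bounds m∈arc))
      (subst₂ _≤_ (sym (+-assoc K N gap)) (sym (σ-after j<l)) (p≤p+q (fromℕ-nonNeg (toℕ l))))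

  arc-left-gap : ∀ {m l} → Arc m → LeftSide i j l → gap ≤ ∣ σ m - σ l ∣
  arc-left-gap {m} {l} m∈arc lL = subst (gap ≤_) (∣p-q∣≡∣q-p∣ (σ l) (σ m)) (left-arc-gap lL m∈arc)

  R²N²<gap³ : R * R * (N * N) < gap * gap * (gap * 1ℚ)
  R²N²<gap³ =
    subst (λ r → r * r * (N * N) < gap * gap * (gap * 1ℚ)) (sym (R≡ N gap)) (cube-dominates 1≤N)
    where
    R≡ : ∀ N g → N + (N + g) + (N + g) ≡ 3 * N + 2 * g
    R≡ = solve-∀ ring

  key-inequality : ∀ {a b c d} → LeftSide i j a → Arc b → LeftSide i j c → Arc d → toℕ b ≢ toℕ d →
    ∣ σ a - σ c ∣ * ∣ σ a - σ d ∣ * (∣ σ b - σ i ∣ * ∣ σ b - σ j ∣)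
      < ∣ σ a - σ i ∣ * ∣ σ a - σ j ∣ * (∣ σ b - σ c ∣ * ∣ σ b - σ d ∣)
  key-inequality {a} {b} {c} {d} aL b∈arc cL d∈arc b≢d = begin-strict
    ∣ σ a - σ c ∣ * ∣ σ a - σ d ∣ * (∣ σ b - σ i ∣ * ∣ σ b - σ j ∣)
      ≤⟨ bound (0≤∣p∣ (σ a - σ c)) (0≤∣p∣ (σ a - σ d)) (0≤∣p∣ (σ b - σ i)) (0≤∣p∣ (σ b - σ j))
               (σ-range a c) (σ-range a d) (arc-width b∈arc i∈arc) (arc-width b∈arc j∈arc) ⟩
    R * R * (N * N)
      <⟨ R²N²<gap³ ⟩
    gap * gap * (gap * 1ℚ)
      ≤⟨ bound 0≤gap 0≤gap 0≤gap (nonNegative⁻¹ 1ℚ)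
               (left-arc-gap aL i∈arc) (left-arc-gap aL j∈arc)
               (arc-left-gap b∈arc cL) (σ-separated b≢d) ⟩
    ∣ σ a - σ i ∣ * ∣ σ a - σ j ∣ * (∣ σ b - σ c ∣ * ∣ σ b - σ d ∣) ∎
    where
    bound : ∀ {p q r s p′ q′ r′ s′} → 0ℚ ≤ p → 0ℚ ≤ q → 0ℚ ≤ r → 0ℚ ≤ s →
            p ≤ p′ → q ≤ q′ → r ≤ r′ → s ≤ s′ → p * q * (r * s) ≤ p′ * q′ * (r′ * s′)
    bound 0≤p 0≤q 0≤r 0≤s p≤p′ q≤q′ r≤r′ s≤s′ =
      *-mono-≤-nonNeg (*-nonNeg 0≤p 0≤q) (*-nonNeg 0≤r 0≤s)
        (*-mono-≤-nonNeg 0≤p 0≤q p≤p′ q≤q′) (*-mono-≤-nonNeg 0≤r 0≤s r≤r′ s≤s′)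

  drawing : ConvexDrawing n
  drawing = circleDrawing σ σ-<

  point : Fin n → Point
  point = pos drawing

  crossing-left-of-chord : ∀ {a b c d x} →
    LeftSide i j a → RightSide i j b → LeftSide i j c → RightSide i j d → toℕ b ≢ toℕ d →
    OnSegment x (point a) (point b) → OnSegment x (point c) (point d) →
    0ℚ < orient (point i) (point j) x
  crossing-left-of-chord {a} {b} {c} {d} aL bR cL dR b≢d x∈ab x∈cd =
    crossing-side (point a) (point b) (point c) (point d) (point i) (point j)
      x∈ab (OnSegment⇒collinear (point c) (point d) x∈cd)
      (leftSide-orient-pos drawing i<j aL) (rightSide-orient-neg drawing bR)
      (circlePoint-crossing-ratio (σ a) (σ b) (σ c) (σ d) (σ i) (σ j)
                                  (<-≤-trans 0<gap (arc-left-gap (rightSide⇒arc dR) cL))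
                                  (<-≤-trans (positive⁻¹ 1ℚ) (σ-separated (ℕₚ.>⇒≢ i<j)))
        (key-inequality aL (rightSide⇒arc bR) cL (rightSide⇒arc dR) b≢d))

  crossing-left : ∀ {a b c d x} → Intertwined a b i j → Intertwined c d i j → Intertwined a b c d →
    OnSegment x (point a) (point b) → OnSegment x (point c) (point d) →
    0ℚ < orient (point i) (point j) x
  crossing-left {a} {b} {c} {d} abij cdij abcd x∈ab x∈cd
    with pierced⇒sides abij | pierced⇒sides cdij | intertwined⇒disjoint abcd
  ... | inj₁ (aL , bR) | inj₁ (cL , dR) | _ , _ , _ , b≢d =
    crossing-left-of-chord aL bR cL dR b≢d x∈ab x∈cd
  ... | inj₁ (aL , bR) | inj₂ (cR , dL) | _ , _ , b≢c , _ =
    crossing-left-of-chord aL bR dL cR b≢c x∈ab (OnSegment-reverse (point c) (point d) x∈cd)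
  ... | inj₂ (aR , bL) | inj₁ (cL , dR) | _ , a≢d , _ , _ =
    crossing-left-of-chord bL aR cL dR a≢d (OnSegment-reverse (point a) (point b) x∈ab) x∈cd
  ... | inj₂ (aR , bL) | inj₂ (cR , dL) | a≢c , _ , _ , _ =
    crossing-left-of-chord bL aR dL cR a≢c
      (OnSegment-reverse (point a) (point b) x∈ab) (OnSegment-reverse (point c) (point d) x∈cd)

lemma4 : (n k : ℕ) (G : Graph n) (Γ : ConvexDrawing n) →
         OuterKPlanar k G Γ →
         (i j : Fin n) → toℕ i ℕ.< toℕ j →
         Σ (ConvexDrawing n) λ Γ' → OuterKPlanar k G Γ' × CrossingsLeft G Γ' i j
lemma4 n k G Γ k-planar i j i<j = drawing , k-planar , crossings-left
  where
  open Clustered i j i<j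
  crossings-left : CrossingsLeft G drawing i j
  crossings-left a b c d _ _ abij cdij abcd x x∈ab x∈cd l lL =
    *-pos (crossing-left abij cdij abcd x∈ab x∈cd) (leftSide-orient-pos drawing i<j lL)
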